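{- For a positive integer $n$, let $\mathcal{P}(n)$ be the power set of $[n]=\{1,\dots,n\}$. Let $\mathcal{Q}_s(n)$ be the set of scarce linear collections $\mathcal{B}\subseteq\mathcal{P}(n)$, and let $\mathcal{A}_I(n)$ be the set of intersecting antichains of the Boolean lattice $\mathcal{P}(n)$ all of whose members are nonempty. Then $\mathcal{Q}_s(n)=\mathcal{A}_I(n)$.
   Context: A collection of sets $\mathcal{B}\neq\{\emptyset\}$ is linear if there do not exist disjoint sets $X,Y$ with $|\{X,Y,X\cup Y\}\cap\mathcal{B}|=2$. A linear collection $\mathcal{B}$ is scarce if $|\{X,Y,X\cup Y\}\cap\mathcal{B}|\le 1$ for all disjoint sets $X,Y$. An antichain of $\mathcal{P}(n)$ (ordered by inclusion) is a collection of subsets no two of which are comparable; it is intersecting if moreover $X\cap Y\neq\emptyset$ for all $X,Y$ in it. -}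

module Defs where

open import Data.Nat using (ℕ; _≤_)
open import Data.Bool using (Bool; true; false; T)
open import Data.Bool.Properties using () renaming (_≟_ to _≟ᵇ_)
open import Data.Fin.Subset using (Subset; _∪_; _∩_; _⊆_; ⊥; Empty; Nonempty)
open import Data.Vec.Properties using (≡-dec)
open import Data.List using (List; []; _∷_; length; filterᵇ; deduplicate)
open import Data.Product using (_×_)
open import Relation.Binary.PropositionalEquality using (_≡_)
open import Relation.Nullary using (¬_)

Collection : ℕ → Set
Collection n = Subset n → Bool

_≟ˢ_ : ∀ {n} (X Y : Subset n) → Relation.Nullary.Dec (X ≡ Y)
_≟ˢ_ = ≡-dec _≟ᵇ_

-- |{X, Y, X ∪ Y} ∩ ℬ| : the three sets are first deduplicated (it is a set).
hits : ∀ {n} → Collection n → Subset n → Subset n → ℕ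
hits B X Y = length (filterᵇ B (deduplicate _≟ˢ_ (X ∷ Y ∷ (X ∪ Y) ∷ [])))

Disjoint : ∀ {n} → Subset n → Subset n → Set
Disjoint X Y = Empty (X ∩ Y)

IsSingletonEmpty : ∀ {n} → Collection n → Set
IsSingletonEmpty {n} B = ∀ (Z : Subset n) → (T (B Z) → Z ≡ ⊥) × (Z ≡ ⊥ → T (B Z))

Linear : ∀ {n} → Collection n → Set
Linear {n} B = ¬ IsSingletonEmpty B
  × (∀ (X Y : Subset n) → Disjoint X Y → ¬ (hits B X Y ≡ 2))

Scarce : ∀ {n} → Collection n → Set
Scarce {n} B = Linear B × (∀ (X Y : Subset n) → Disjoint X Y → hits B X Y ≤ 1)

Antichain : ∀ {n} → Collection n → Set
Antichain {n} B = ∀ (X Y : Subset n) → T (B X) → T (B Y) → X ⊆ Y → X ≡ Y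

Intersecting : ∀ {n} → Collection n → Set
Intersecting {n} B = ∀ (X Y : Subset n) → T (B X) → T (B Y) → Nonempty (X ∩ Y)

MembersNonempty : ∀ {n} → Collection n → Set
MembersNonempty {n} B = ∀ (X : Subset n) → T (B X) → Nonempty X

InAI : ∀ {n} → Collection n → Set
InAI B = Antichain B × Intersecting B × MembersNonempty B

{-# OPTIONS --safe #-}
module Submission where

-- Scarcity says that for disjoint X, Y at most one of X, Y, X ∪ Y lies in ℬ
-- (linearity then follows).  For members A ⊊ C this fails at X := A, Y := C ─ A,
-- for disjoint members A ≠ C at X := A, Y := C, and a member ∅ together with any
-- member Z ≠ ∅ fails at (∅, Z), so ∅ ∈ ℬ forces ℬ = {∅}.  Conversely, two
-- distinct sets among X, Y, X ∪ Y are comparable unless they are X and Y,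
-- which are disjoint.

open import Defs
open import Data.Nat using (ℕ; _≤_; z≤n; s≤s)
open import Data.Nat.Properties using (<⇒≢)
open import Data.Bool using (Bool; T)
open import Data.Bool.Properties using (T?)
open import Data.Empty using (⊥-elim)
open import Data.Fin using (Fin)
open import Data.Fin.Subset using (Subset; _∪_; _∩_; _─_; _⊆_; _∈_; _∉_; ⊥; inside)
open import Data.Fin.Subset.Properties
  using (nonempty?; Empty-unique; ∉⊥; _∈?_; ⊆-refl; ⊆-antisym; p⊆p∪q; q⊆p∪q; x∈p∩q⁺; x∈p∩q⁻; x∈p∪q⁻; p─q⊆p; x∈p∧x∉q⇒x∈p─q)
open import Data.Vec using (_∷_; here; there)
open import Data.List using (List; []; _∷_; length; filterᵇ; deduplicate)
import Data.List.Membership.Propositional as List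
open import Data.List.Membership.Propositional.Properties using (∈-filter⁺; ∈-filter⁻; ∈-deduplicate⁺; ∈-deduplicate⁻)
open import Data.List.Relation.Unary.Any using (here; there)
open import Data.List.Relation.Unary.All using (_∷_)
open import Data.List.Relation.Unary.Unique.Propositional using (Unique; _∷_)
open import Data.List.Relation.Unary.Unique.Propositional.Properties using (filter⁺)
open import Data.List.Relation.Unary.Unique.DecPropositional.Properties using (deduplicate-!)
open import Data.Product using (_×_; _,_; proj₁; proj₂; swap)
open import Data.Sum using (_⊎_; inj₁; inj₂; [_,_])
open import Function using (_∘_)
open import Function.Bundles using (_⇔_; mk⇔; Equivalence)
open import Relation.Binary.Definitions using (DecidableEquality)
open import Relation.Binary.PropositionalEquality using (_≡_; refl; sym; trans; subst)
open import Relation.Nullary using (¬_; yes; no)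

module _ {A : Set} where

  AtMostOne : (A → Bool) → List A → Set
  AtMostOne p xs = ∀ {a b} → a List.∈ xs → b List.∈ xs → T (p a) → T (p b) → a ≡ b

  length≤1⇒∈-unique : ∀ {xs : List A} {a b} → length xs ≤ 1 → a List.∈ xs → b List.∈ xs → a ≡ b
  length≤1⇒∈-unique {_ ∷ []} _ (here refl) (here refl) = refl
  length≤1⇒∈-unique {_ ∷ _ ∷ _} (s≤s ()) _ _

  ∈-unique⇒length≤1 : ∀ {xs : List A} → Unique xs →
                      (∀ {a b} → a List.∈ xs → b List.∈ xs → a ≡ b) → length xs ≤ 1
  ∈-unique⇒length≤1 {[]} _ _ = z≤n
  ∈-unique⇒length≤1 {_ ∷ []} _ _ = s≤s z≤n
  ∈-unique⇒length≤1 {_ ∷ _ ∷ _} ((a≢b ∷ _) ∷ _) same = ⊥-elim (a≢b (same (here refl) (there (here refl))))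

  length-filter-deduplicate≤1⇔AtMostOne : ∀ (_≟_ : DecidableEquality A) (p : A → Bool) (xs : List A) →
                                          length (filterᵇ p (deduplicate _≟_ xs)) ≤ 1 ⇔ AtMostOne p xs
  length-filter-deduplicate≤1⇔AtMostOne _≟_ p xs = mk⇔ to from
    where
    ys : List A
    ys = filterᵇ p (deduplicate _≟_ xs)

    ∈-kept : ∀ {a} → a List.∈ xs → T (p a) → a List.∈ ys
    ∈-kept a∈ pa = ∈-filter⁺ (T? ∘ p) (∈-deduplicate⁺ _≟_ a∈) pa

    ∈-source : ∀ {a} → a List.∈ ys → a List.∈ xs × T (p a)
    ∈-source a∈ with ∈-filter⁻ (T? ∘ p) a∈
    ... | a∈dedup , pa = ∈-deduplicate⁻ _≟_ xs a∈dedup , pa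

    to : length ys ≤ 1 → AtMostOne p xs
    to ≤1 a∈ b∈ pa pb = length≤1⇒∈-unique ≤1 (∈-kept a∈ pa) (∈-kept b∈ pb)

    from : AtMostOne p xs → length ys ≤ 1
    from same = ∈-unique⇒length≤1 (filter⁺ (T? ∘ p) (deduplicate-! _≟_ xs)) λ a∈ b∈ →
      let a∈xs , pa = ∈-source a∈; b∈xs , pb = ∈-source b∈ in same a∈xs b∈xs pa pb

private variable n : ℕ

x∈p─q⇒x∉q : ∀ {x : Fin n} {p q : Subset n} → x ∈ p ─ q → x ∉ q
x∈p─q⇒x∉q {p = _ ∷ _} {inside ∷ _} () here
x∈p─q⇒x∉q {p = _ ∷ _} {_ ∷ _} (there x∈p─q) (there x∈q) = x∈p─q⇒x∉q x∈p─q x∈q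

Disjoint-p-q─p : (p q : Subset n) → Disjoint p (q ─ p)
Disjoint-p-q─p p q (x , x∈) with x∈p∩q⁻ p (q ─ p) x∈
... | x∈p , x∈q─p = x∈p─q⇒x∉q x∈q─p x∈p

p⊆q⇒p∪[q─p]≡q : {p q : Subset n} → p ⊆ q → p ∪ (q ─ p) ≡ q
p⊆q⇒p∪[q─p]≡q {p = p} {q = q} p⊆q = ⊆-antisym ∪⊆q q⊆∪
  where
  ∪⊆q : p ∪ (q ─ p) ⊆ q
  ∪⊆q x∈ = [ p⊆q , p─q⊆p q p ] (x∈p∪q⁻ p (q ─ p) x∈)

  q⊆∪ : q ⊆ p ∪ (q ─ p)
  q⊆∪ {x} x∈q with x ∈? p
  ... | yes x∈p = p⊆p∪q (q ─ p) x∈p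
  ... | no x∉p = q⊆p∪q p (q ─ p) (x∈p∧x∉q⇒x∈p─q x∈q x∉p)

Disjoint-sym : {p q : Subset n} → Disjoint p q → Disjoint q p
Disjoint-sym {p = p} {q = q} dj (x , x∈) = dj (x , x∈p∩q⁺ (swap (x∈p∩q⁻ q p x∈)))

Triple : Subset n → Subset n → List (Subset n)
Triple X Y = X ∷ Y ∷ (X ∪ Y) ∷ []

Triple-comparable-or-disjoint : {X Y Z W : Subset n} → Disjoint X Y →
                                Z List.∈ Triple X Y → W List.∈ Triple X Y →
                                Z ⊆ W ⊎ W ⊆ Z ⊎ Disjoint Z W
Triple-comparable-or-disjoint dj (here refl) (here refl) = inj₁ ⊆-refl
Triple-comparable-or-disjoint dj (here refl) (there (here refl)) = inj₂ (inj₂ dj)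
Triple-comparable-or-disjoint {Y = Y} dj (here refl) (there (there (here refl))) = inj₁ (p⊆p∪q Y)
Triple-comparable-or-disjoint dj (there (here refl)) (here refl) = inj₂ (inj₂ (Disjoint-sym dj))
Triple-comparable-or-disjoint dj (there (here refl)) (there (here refl)) = inj₁ ⊆-refl
Triple-comparable-or-disjoint {X = X} dj (there (here refl)) (there (there (here refl))) = inj₁ (q⊆p∪q X _)
Triple-comparable-or-disjoint {Y = Y} dj (there (there (here refl))) (here refl) = inj₂ (inj₁ (p⊆p∪q Y))
Triple-comparable-or-disjoint {X = X} dj (there (there (here refl))) (there (here refl)) = inj₂ (inj₁ (q⊆p∪q X _))
Triple-comparable-or-disjoint dj (there (there (here refl))) (there (there (here refl))) = inj₁ ⊆-refl

hits≤1⇔AtMostOne : (B : Collection n) (X Y : Subset n) → hits B X Y ≤ 1 ⇔ AtMostOne B (Triple X Y)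
hits≤1⇔AtMostOne B X Y = length-filter-deduplicate≤1⇔AtMostOne _≟ˢ_ B (Triple X Y)

module _ {n : ℕ} (B : Collection n) where

  Scarce⇒AtMostOne : Scarce B → ∀ {X Y} → Disjoint X Y → AtMostOne B (Triple X Y)
  Scarce⇒AtMostOne (_ , ≤1) {X} {Y} dj = Equivalence.to (hits≤1⇔AtMostOne B X Y) (≤1 X Y dj)

  Scarce⇒MembersNonempty : Scarce B → MembersNonempty B
  Scarce⇒MembersNonempty sc@((¬only∅ , _) , _) X BX with nonempty? X
  ... | yes X≢∅ = X≢∅
  ... | no X-empty = ⊥-elim (¬only∅ λ Z → only-∅ Z , λ { refl → subst (T ∘ B) X≡⊥ BX })
    where
    X≡⊥ : X ≡ ⊥
    X≡⊥ = Empty-unique X-empty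

    only-∅ : ∀ Z → T (B Z) → Z ≡ ⊥
    only-∅ Z BZ = trans (sym (Scarce⇒AtMostOne sc X-disjoint (here refl) (there (here refl)) BX BZ)) X≡⊥
      where
      X-disjoint : Disjoint X Z
      X-disjoint (x , x∈X∩Z) = X-empty (x , proj₁ (x∈p∩q⁻ X Z x∈X∩Z))

  Scarce⇒Antichain : Scarce B → Antichain B
  Scarce⇒Antichain sc X Y BX BY X⊆Y =
    trans (Scarce⇒AtMostOne sc (Disjoint-p-q─p X Y) (here refl) (there (there (here refl))) BX B[X∪[Y─X]])
          X∪[Y─X]≡Y
    where
    X∪[Y─X]≡Y : X ∪ (Y ─ X) ≡ Y
    X∪[Y─X]≡Y = p⊆q⇒p∪[q─p]≡q X⊆Y

    B[X∪[Y─X]] : T (B (X ∪ (Y ─ X)))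
    B[X∪[Y─X]] = subst (T ∘ B) (sym X∪[Y─X]≡Y) BY

  Scarce⇒Intersecting : Scarce B → Intersecting B
  Scarce⇒Intersecting sc X Y BX BY with nonempty? (X ∩ Y)
  ... | yes X∩Y≢∅ = X∩Y≢∅
  ... | no X∩Y-empty with Scarce⇒AtMostOne sc X∩Y-empty (here refl) (there (here refl)) BX BY
  ... | refl = let x , x∈X = Scarce⇒MembersNonempty sc X BX in x , x∈p∩q⁺ (x∈X , x∈X)

  Scarce⇒InAI : Scarce B → InAI B
  Scarce⇒InAI sc = Scarce⇒Antichain sc , Scarce⇒Intersecting sc , Scarce⇒MembersNonempty sc

  InAI⇒Scarce : InAI B → Scarce B
  InAI⇒Scarce (antichain , intersecting , membersNonempty) = (¬only∅ , λ X Y dj → <⇒≢ (s≤s (≤1 X Y dj))) , ≤1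
    where
    ¬only∅ : ¬ IsSingletonEmpty B
    ¬only∅ only∅ = let x , x∈⊥ = membersNonempty ⊥ (proj₂ (only∅ ⊥) refl) in ∉⊥ x∈⊥

    ≤1 : ∀ X Y → Disjoint X Y → hits B X Y ≤ 1
    ≤1 X Y dj = Equivalence.from (hits≤1⇔AtMostOne B X Y) λ Z∈ W∈ BZ BW →
      [ antichain _ _ BZ BW
      , [ sym ∘ antichain _ _ BW BZ , (λ Z∩W-empty → ⊥-elim (Z∩W-empty (intersecting _ _ BZ BW))) ]
      ] (Triple-comparable-or-disjoint dj Z∈ W∈)

lemma3p1 : (n : ℕ) → 1 ≤ n → (B : Collection n) → Scarce B ⇔ InAI B
lemma3p1 n _ B = mk⇔ (Scarce⇒InAI B) (InAI⇒Scarce B)
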